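{- If $r,r_0\ge0$, $0\le k\le 2^r$ and $0\le k_0\le 2^{r_0}-1$, then for all $a,b$, $$Z(r+r_0,\,2^rk_0+k;\,a,b) = Z\big(r,k;\,Z(r_0,k_0;a,b),\,Z(r_0,k_0+1;a,b)\big).$$
   Context: For numbers (or indeterminates) $a,b$, the diatomic array $Z(r,k)=Z(r,k;a,b)$, for $r\ge0$ and $0\le k\le 2^r$, is defined recursively by $Z(0,0)=a$, $Z(0,1)=b$, $Z(r+1,2k)=Z(r,k)$ for $0\le k\le 2^r$, and $Z(r+1,2k+1)=Z(r,k)+Z(r,k+1)$ for $0\le k\le 2^r-1$. -}

module Defs where

open import Data.Nat using (ℕ; zero; suc; _/_; _%_)

-- Diatomic array Z(r,k;a,b) over an arbitrary carrier A with a binary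
-- operation _+_ (numbers, or indeterminates via free structures).
-- Values with k > 2^r are junk and are never used by the statement.
module Diatomic {A : Set} (_+_ : A → A → A) where

  Z : ℕ → ℕ → A → A → A
  Z zero zero a b = a
  Z zero (suc k) a b = b
  Z (suc r) k a b with k % 2
  ... | zero = Z r (k / 2) a b
  ... | suc _ = Z r (k / 2) a b + Z r (suc (k / 2)) a b

{-# OPTIONS --safe #-}
-- By the recursion for Z, column 2^(r+1)·k₀ + k of row
-- r+1+r₀ is column 2^r·k₀ + ⌊k/2⌋ of row r+r₀ when k is even, and the sum of
-- that column and the next one when k is odd; Z(r+1,k;c,d) is expressed
-- through row r in exactly the same way.  For r = 0 the two columns k = 0, 1
-- are the two ends Z(r₀,k₀) and Z(r₀,k₀+1) of block k₀.
module Submission where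

open import Defs
open import Data.Fin using (zero; suc)
open import Data.Nat using (ℕ; suc; _+_; _*_; _^_; _≤_; _<_; s≤s; _/_; _%_)
open import Data.Nat.Divisibility using (divides-refl)
open import Data.Nat.DivMod
  using (_divMod_; result; m*n%n≡0; m*n/n≡m; [m+kn]%n≡m%n; +-distrib-/-∣ʳ)
open import Data.Nat.Properties
  using (+-comm; +-suc; +-identityʳ; *-comm; *-identityˡ; *-cancelʳ-≤; *-cancelʳ-<; <⇒≤)
open import Data.Nat.Tactic.RingSolver using (solve-∀)
open import Relation.Binary.PropositionalEquality
  using (_≡_; refl; cong; cong₂; sym; trans; subst; module ≡-Reasoning)

[1+m*2]%2≡1 : ∀ m → suc (m * 2) % 2 ≡ 1
[1+m*2]%2≡1 m = [m+kn]%n≡m%n 1 m 2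

[1+m*2]/2≡m : ∀ m → suc (m * 2) / 2 ≡ m
[1+m*2]/2≡m m = trans (+-distrib-/-∣ʳ 1 {d = 2} (divides-refl m)) (m*n/n≡m m 2)

m*2≤2*n⇒m≤n : ∀ {m n} → m * 2 ≤ 2 * n → m ≤ n
m*2≤2*n⇒m≤n {m} {n} le = *-cancelʳ-≤ m n 2 (subst (m * 2 ≤_) (*-comm 2 n) le)

1+m*2≤2*n⇒m<n : ∀ {m n} → suc (m * 2) ≤ 2 * n → m < n
1+m*2≤2*n⇒m<n {m} {n} le = *-cancelʳ-< 2 m n (subst (m * 2 <_) (*-comm 2 n) le)

2*p*k+m*2≡[p*k+m]*2 : ∀ p k m → 2 * p * k + m * 2 ≡ (p * k + m) * 2
2*p*k+m*2≡[p*k+m]*2 = solve-∀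

module _ {A : Set} (_⊕_ : A → A → A) where
  open Diatomic _⊕_
  open ≡-Reasoning

  Z-cong-column : ∀ r {i j} a b → i ≡ j → Z r i a b ≡ Z r j a b
  Z-cong-column r a b = cong (λ i → Z r i a b)

  Z-even : ∀ r m a b → Z (suc r) (m * 2) a b ≡ Z r m a b
  Z-even r m a b rewrite m*n%n≡0 m 2 ⦃ _ ⦄ | m*n/n≡m m 2 ⦃ _ ⦄ = refl

  Z-odd : ∀ r m a b → Z (suc r) (suc (m * 2)) a b ≡ Z r m a b ⊕ Z r (suc m) a b
  Z-odd r m a b rewrite [1+m*2]%2≡1 m | [1+m*2]/2≡m m = refl

  Z-block : ∀ r r₀ k k₀ → k ≤ 2 ^ r → ∀ a b →
    Z (r + r₀) (2 ^ r * k₀ + k) a b ≡ Z r k (Z r₀ k₀ a b) (Z r₀ (suc k₀) a b)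
  Z-block 0 r₀ 0 k₀ _ a b =
    Z-cong-column r₀ a b (trans (+-identityʳ (1 * k₀)) (*-identityˡ k₀))
  Z-block 0 r₀ 1 k₀ _ a b =
    Z-cong-column r₀ a b (trans (+-comm (1 * k₀) 1) (cong suc (*-identityˡ k₀)))
  Z-block 0 r₀ (suc (suc _)) k₀ (s≤s ()) a b
  Z-block (suc r) r₀ k k₀ k≤2^[1+r] a b with k divMod 2
  ... | result m zero refl = begin
    Z (suc (r + r₀)) (2 ^ suc r * k₀ + m * 2) a b  ≡⟨ Z-cong-column _ a b (2*p*k+m*2≡[p*k+m]*2 (2 ^ r) k₀ m) ⟩
    Z (suc (r + r₀)) ((2 ^ r * k₀ + m) * 2) a b    ≡⟨ Z-even (r + r₀) _ a b ⟩
    Z (r + r₀) (2 ^ r * k₀ + m) a b                ≡⟨ Z-block r r₀ m k₀ (m*2≤2*n⇒m≤n k≤2^[1+r]) a b ⟩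
    Z r m c d                                      ≡⟨ Z-even r m c d ⟨
    Z (suc r) (m * 2) c d                          ∎
    where
      c = Z r₀ k₀ a b
      d = Z r₀ (suc k₀) a b
  ... | result m (suc zero) refl = begin
    Z (suc (r + r₀)) (2 ^ suc r * k₀ + suc (m * 2)) a b  ≡⟨ Z-cong-column _ a b index ⟩
    Z (suc (r + r₀)) (suc ((2 ^ r * k₀ + m) * 2)) a b    ≡⟨ Z-odd (r + r₀) _ a b ⟩
    Z (r + r₀) (2 ^ r * k₀ + m) a b ⊕ Z (r + r₀) (suc (2 ^ r * k₀ + m)) a b
      ≡⟨ cong₂ _⊕_ (Z-block r r₀ m k₀ (<⇒≤ m<2^r) a b) next-column ⟩
    Z r m c d ⊕ Z r (suc m) c d                           ≡⟨ Z-odd r m c d ⟨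
    Z (suc r) (suc (m * 2)) c d                           ∎
    where
      c = Z r₀ k₀ a b
      d = Z r₀ (suc k₀) a b
      m<2^r : m < 2 ^ r
      m<2^r = 1+m*2≤2*n⇒m<n k≤2^[1+r]
      index : 2 ^ suc r * k₀ + suc (m * 2) ≡ suc ((2 ^ r * k₀ + m) * 2)
      index = trans (+-suc _ (m * 2)) (cong suc (2*p*k+m*2≡[p*k+m]*2 (2 ^ r) k₀ m))
      next-column : Z (r + r₀) (suc (2 ^ r * k₀ + m)) a b ≡ Z r (suc m) c d
      next-column = trans (Z-cong-column (r + r₀) a b (sym (+-suc (2 ^ r * k₀) m)))
                          (Z-block r r₀ (suc m) k₀ m<2^r a b)

lemma2p3 : {A : Set} (_⊕_ : A → A → A) (r r₀ k k₀ : ℕ) →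
    k ≤ 2 ^ r → k₀ < 2 ^ r₀ → (a b : A) →
    Diatomic.Z _⊕_ (r + r₀) (2 ^ r * k₀ + k) a b
      ≡ Diatomic.Z _⊕_ r k (Diatomic.Z _⊕_ r₀ k₀ a b) (Diatomic.Z _⊕_ r₀ (suc k₀) a b)
lemma2p3 _⊕_ r r₀ k k₀ k≤2^r _ = Z-block _⊕_ r r₀ k k₀ k≤2^r
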